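{- Let $\mathcal F$ be a filter on $\omega$. The following are equivalent: (1) $\mathcal F$ is a completely meager P$^+$-filter. (2) For every sequence $\langle X_i:i\in\omega\rangle$ of subsets of $\omega$ such that $\bigcup_{i\ge n}X_i\in\mathcal F^+$ for each $n$, there exist $h\in{}^\omega\omega$ and a strictly increasing sequence $n_0<n_1<\cdots$ such that for every $Y\in\mathcal F$ and all but finitely many $k$, \[ Y\cap\bigcup_{i\in[n_k,n_{k+1})}\big(X_i\cap h(i)\big)\neq\emptyset. \] (3) For every sequence $\langle X_i:i\in\omega\rangle\subseteq\mathcal F^+$, there exist $h\in{}^\omega\omega$ and a strictly increasing sequence $n_0<n_1<\cdots$ such that for every $Y\in\mathcal F$ and all but finitely many $k$, \[ Y\cap\bigcup_{i\in[n_k,n_{k+1})}\big(X_i\cap h(i)\big)\neq\emptyset. \]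
   Context: A filter on $\omega$ is a family of subsets of $\omega$ closed under finite intersections and supersets and containing all cofinite sets. $\mathcal F^+=\{X\subseteq\omega:\omega\setminus X\notin\mathcal F\}$. $A\subseteq^*B$ means $A\setminus B$ is finite. A natural number $h(i)$ is identified with the set $\{0,\dots,h(i)-1\}$. $\mathcal F$ is completely meager if the filter generated by $\mathcal F\cup\{X\}$ is meager (as a subset of $2^\omega$, identifying sets with characteristic functions, product topology) whenever $X\in\mathcal F^+$. $\mathcal F$ is a P$^+$-filter if for every sequence $X_0\supseteq^*X_1\supseteq^*X_2\supseteq^*\cdots$ of members of $\mathcal F^+$ there is $X\in\mathcal F^+$ with $X\subseteq^*X_n$ for all $n$. -}

module Defs where

open import Level using (Level; 0ℓ) renaming (suc to lsuc)
open import Data.Nat using (ℕ; zero; suc; _≤_; _<_)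
open import Data.Bool using (Bool; true; false)
open import Data.List using (List; []; _∷_; _++_)
open import Data.Unit using (⊤)
open import Data.Product using (Σ; _×_; _,_)
open import Relation.Nullary using (¬_)
open import Relation.Binary.PropositionalEquality using (_≡_)
open import Function.Bundles using (_⇔_)

Subset : Set
Subset = ℕ → Bool

_∈_ : ℕ → Subset → Set
n ∈ X = X n ≡ true

_⊆_ : Subset → Subset → Set
X ⊆ Y = ∀ n → n ∈ X → n ∈ Y

_⊆*_ : Subset → Subset → Set
X ⊆* Y = Σ ℕ λ N → ∀ n → N ≤ n → n ∈ X → n ∈ Y

comp : Subset → Subset
comp X n with X n
... | true = false
... | false = true


inter : Subset → Subset → Subset
inter X Y n with X n
... | true = Y n
... | false = false

Cofinite : Subset → Set
Cofinite X = Σ ℕ λ N → ∀ n → N ≤ n → n ∈ X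

Family : Set₁
Family = Subset → Set

record IsFilter (F : Family) : Set where
  field
    inter-closed : ∀ X Y → F X → F Y → F (inter X Y)
    super-closed : ∀ X Y → F X → X ⊆ Y → F Y
    cofinite     : ∀ X → Cofinite X → F X

_⁺ : Family → Family
(F ⁺) X = ¬ F (comp X)

-- Topology of 2^ω: basic open sets [s] for finite binary strings s.
Extends : Subset → List Bool → Set
Extends x []      = ⊤
Extends x (b ∷ s) = (x 0 ≡ b) × Extends (λ n → x (suc n)) s

NowhereDense : Family → Set
NowhereDense A = ∀ (s : List Bool) → Σ (List Bool) λ t →
  ∀ x → A x → ¬ Extends x (s ++ t)

Meager : Family → Set₁
Meager A = Σ (ℕ → Family) λ N → (∀ k → NowhereDense (N k)) ×
  (∀ x → A x → Σ ℕ λ k → N k x)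

-- The filter generated by F ∪ {X} (F a filter): supersets of Y ∩ X, Y ∈ F.
GenBy : Family → Subset → Family
GenBy F X Z = Σ Subset λ Y → F Y × (∀ n → n ∈ Y → n ∈ X → n ∈ Z)

CompletelyMeager : Family → Set₁
CompletelyMeager F = ∀ X → (F ⁺) X → Meager (GenBy F X)

IsPPlus : Family → Set
IsPPlus F = ∀ (X : ℕ → Subset) → (∀ n → (F ⁺) (X n)) →
  (∀ n → X (suc n) ⊆* X n) →
  Σ Subset λ Z → (F ⁺) Z × (∀ n → Z ⊆* X n)

Represents : Subset → (ℕ → Set) → Set
Represents Z P = ∀ m → (m ∈ Z) ⇔ P m

UnionFrom : (ℕ → Subset) → ℕ → ℕ → Set
UnionFrom X n m = Σ ℕ λ i → n ≤ i × m ∈ X i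

Catches : Family → (ℕ → Subset) → Set
Catches F X = Σ (ℕ → ℕ) λ h → Σ (ℕ → ℕ) λ nk →
  (∀ k → nk k < nk (suc k)) ×
  (∀ Y → F Y → Σ ℕ λ K → ∀ k → K ≤ k →
     Σ ℕ λ i → (nk k ≤ i × i < nk (suc k)) ×
       Σ ℕ λ m → m < h i × m ∈ X i × m ∈ Y)

Cond1 : Family → Set₁
Cond1 F = CompletelyMeager F × IsPPlus F

Cond2 : Family → Set
Cond2 F = ∀ (X : ℕ → Subset) →
  (∀ n Z → Represents Z (UnionFrom X n) → (F ⁺) Z) → Catches F X

Cond3 : Family → Set
Cond3 F = ∀ (X : ℕ → Subset) → (∀ i → (F ⁺) (X i)) → Catches F X

-- (3) ⇒ (1) and (1) ⇒ (2) both pass through Talagrand's characterisation: an upward closed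
-- family A ⊆ 2^ω is meager iff there is an interval partition such that every member of A
-- meets all but finitely many intervals. Given (3) and X ∈ F⁺, the tails X ∩ [i, ∞) produce
-- such a partition for the filter generated by F ∪ {X}; and for a ⊆*-decreasing chain, made
-- ⊆-decreasing by cutting off finite pieces, the points below h i in X i form a positive set
-- almost contained in every member of the chain. Conversely, P⁺ gives a positive Z almost
-- contained in every tail union ⋃_{i ≥ n} X i; complete meagerness gives a partition met by
-- every Y ∩ Z, Y ∈ F, and grouping the indices i witnessing those points into blocks yields
-- the sequence n_k and the bound h. (2) ⇒ (3) is immediate.
module Submission where

open import Defs
open import Level using (Level; 0ℓ)
open import Data.Nat using (ℕ; zero; suc; _+_; _∸_; _≤_; _<_; _≤′_; ≤′-refl; ≤′-step; z≤n; s≤s; _⊔_)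
open import Data.Nat.Properties
open import Data.Bool as Bool using (Bool; true; false; _∨_)
open import Data.Bool.Properties using (¬-not; not-¬)
open import Data.List using (List; []; _∷_; _++_; length; map; replicate)
open import Data.List.Properties using (length-++; ++-assoc; ++-identityʳ)
open import Data.List.Membership.Propositional using () renaming (_∈_ to _∈ₗ_)
open import Data.List.Membership.Propositional.Properties using (∈-map⁺; ∈-++⁺ˡ; ∈-++⁺ʳ)
open import Data.List.Relation.Unary.All as All using (All; []; _∷_)
open import Data.List.Relation.Unary.Any using (here)
open import Data.Unit using (tt)
open import Data.Empty using (⊥-elim)
open import Data.Sum using (_⊎_; inj₁; inj₂)
open import Data.Product using (Σ; ∃; _×_; _,_; proj₁; proj₂)
open import Relation.Nullary using (¬_; Dec; yes; no; contradiction)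
open import Relation.Nullary.Decidable using (_×-dec_; does; dec-true)
open import Relation.Unary as U using ()
open import Relation.Binary.PropositionalEquality
open import Function using (_∘′_; case_of_)
open import Function.Bundles using (_⇔_; mk⇔; Equivalence)
open import Axiom.ExcludedMiddle using (ExcludedMiddle)

Increasing : (ℕ → ℕ) → Set
Increasing f = ∀ j → f j < f (suc j)

Eventually : (ℕ → Set) → Set
Eventually P = Σ ℕ λ K → ∀ k → K ≤ k → P k

module _ {f : ℕ → ℕ} (f-inc : Increasing f) where

  increasing-mono′ : ∀ {i j} → i ≤′ j → f i ≤ f j
  increasing-mono′ ≤′-refl       = ≤-refl
  increasing-mono′ (≤′-step i≤j) = ≤-trans (increasing-mono′ i≤j) (<⇒≤ (f-inc _))

  increasing-mono : ∀ {i j} → i ≤ j → f i ≤ f j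
  increasing-mono i≤j = increasing-mono′ (≤⇒≤′ i≤j)

  increasing-inflationary : ∀ j → j ≤ f j
  increasing-inflationary zero    = z≤n
  increasing-inflationary (suc j) = ≤-<-trans (increasing-inflationary j) (f-inc j)

maxBelow : (ℕ → ℕ) → ℕ → ℕ
maxBelow f zero    = 0
maxBelow f (suc b) = maxBelow f b ⊔ f b

≤-maxBelow : ∀ f {b i} → i < b → f i ≤ maxBelow f b
≤-maxBelow f {suc b} i<1+b with m≤n⇒m<n∨m≡n (≤-pred i<1+b)
... | inj₁ i<b  = ≤-trans (≤-maxBelow f i<b) (m≤m⊔n _ _)
... | inj₂ refl = m≤n⊔m _ _

shift : ℕ → Subset → Subset
shift n x m = x (n + m)

nth : List Bool → ℕ → Bool
nth []      i       = false
nth (b ∷ p) zero    = b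
nth (b ∷ p) (suc i) = nth p i

nth-++ˡ : ∀ p q {i} → i < length p → nth (p ++ q) i ≡ nth p i
nth-++ˡ (b ∷ p) q {zero}  _         = refl
nth-++ˡ (b ∷ p) q {suc i} (s≤s i<p) = nth-++ˡ p q i<p

nth⇒Extends : ∀ x p → (∀ i → i < length p → x i ≡ nth p i) → Extends x p
nth⇒Extends x []      agree = tt
nth⇒Extends x (b ∷ p) agree =
  agree 0 (s≤s z≤n) , nth⇒Extends (shift 1 x) p (λ i i<p → agree (suc i) (s≤s i<p))

Extends-cong : ∀ {x y} p → (∀ i → i < length p → x i ≡ y i) → Extends x p → Extends y p
Extends-cong []      agree _        = tt
Extends-cong (b ∷ p) agree (e , es) =
  trans (sym (agree 0 (s≤s z≤n))) e , Extends-cong p (λ i i<p → agree (suc i) (s≤s i<p)) es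

Extends-++⁻ˡ : ∀ x p q → Extends x (p ++ q) → Extends x p
Extends-++⁻ˡ x []      q _        = tt
Extends-++⁻ˡ x (b ∷ p) q (e , es) = e , Extends-++⁻ˡ (shift 1 x) p q es

Extends-++⁻ʳ : ∀ x p q → Extends x (p ++ q) → Extends (shift (length p) x) q
Extends-++⁻ʳ x []      q e        = e
Extends-++⁻ʳ x (b ∷ p) q (_ , es) = Extends-++⁻ʳ (shift 1 x) p q es

Extends-replicate : ∀ x n b → Extends x (replicate n b) → ∀ i → i < n → x i ≡ b
Extends-replicate x (suc n) b (e , es) zero    _         = e
Extends-replicate x (suc n) b (e , es) (suc i) (s≤s i<n) = Extends-replicate (shift 1 x) n b es i i<n

prefix : Subset → ℕ → List Bool
prefix x zero    = []
prefix x (suc n) = x 0 ∷ prefix (shift 1 x) n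

Extends-prefix-++ : ∀ x n q → Extends (shift n x) q → Extends x (prefix x n ++ q)
Extends-prefix-++ x zero    q e = e
Extends-prefix-++ x (suc n) q e = refl , Extends-prefix-++ (shift 1 x) n q e

strings : ℕ → List (List Bool)
strings zero    = [] ∷ []
strings (suc n) = map (true ∷_) (strings n) ++ map (false ∷_) (strings n)

prefix∈strings : ∀ x n → prefix x n ∈ₗ strings n
prefix∈strings x zero = here refl
prefix∈strings x (suc n) with x 0
... | true  = ∈-++⁺ˡ (∈-map⁺ (true ∷_) (prefix∈strings (shift 1 x) n))
... | false = ∈-++⁺ʳ (map (true ∷_) (strings n)) (∈-map⁺ (false ∷_) (prefix∈strings (shift 1 x) n))

Avoids : Family → List Bool → Set
Avoids A p = ∀ x → A x → ¬ Extends x p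

Avoids-++ : ∀ {A} p q → Avoids A p → Avoids A (p ++ q)
Avoids-++ p q av x Ax e = av x Ax (Extends-++⁻ˡ x p q e)

NowhereDense-⊆ : ∀ {A B : Family} → (∀ x → B x → A x) → NowhereDense A → NowhereDense B
NowhereDense-⊆ B⊆A ndA s with ndA s
... | t , av = t , λ x Bx → av x (B⊆A x Bx)

NowhereDense-∪ : ∀ {A B : Family} → NowhereDense A → NowhereDense B →
  NowhereDense (λ x → A x ⊎ B x)
NowhereDense-∪ ndA ndB s with ndA s
... | t₁ , av₁ with ndB (s ++ t₁)
... | t₂ , av₂ = t₁ ++ t₂ , λ where
  x (inj₁ Ax) → Avoids-++ (s ++ t₁) t₂ av₁ x Ax ∘′ subst (Extends x) (sym (++-assoc s t₁ t₂))
  x (inj₂ Bx) → av₂ x Bx ∘′ subst (Extends x) (sym (++-assoc s t₁ t₂))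

UpTo : (ℕ → Family) → ℕ → Family
UpTo N j x = Σ ℕ λ i → i ≤ j × N i x

NowhereDense-UpTo : ∀ {N} → (∀ k → NowhereDense (N k)) → ∀ j → NowhereDense (UpTo N j)
NowhereDense-UpTo nd zero = NowhereDense-⊆ (λ { x (.0 , z≤n , N₀x) → N₀x }) (nd 0)
NowhereDense-UpTo {N} nd (suc j) =
  NowhereDense-⊆ split (NowhereDense-∪ (NowhereDense-UpTo nd j) (nd (suc j)))
  where
  split : ∀ x → UpTo N (suc j) x → UpTo N j x ⊎ N (suc j) x
  split x (i , i≤1+j , Nᵢx) with m≤n⇒m<n∨m≡n i≤1+j
  ... | inj₁ i<1+j = inj₁ (i , ≤-pred i<1+j , Nᵢx)
  ... | inj₂ refl  = inj₂ Nᵢx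

avoidAll : ∀ {A} → NowhereDense A → (ss : List (List Bool)) →
  Σ (List Bool) λ t → All (λ s → Avoids A (s ++ t)) ss
avoidAll nd []       = [] , []
avoidAll {A} nd (s ∷ ss) with avoidAll nd ss
... | t₁ , av₁ with nd (s ++ t₁)
... | t₂ , av₂ =
  t₁ ++ t₂ , reassoc s av₂ ∷ All.map (λ {s'} av → reassoc s' (Avoids-++ (s' ++ t₁) t₂ av)) av₁
  where
  reassoc : ∀ s' → Avoids A ((s' ++ t₁) ++ t₂) → Avoids A (s' ++ t₁ ++ t₂)
  reassoc s' = subst (Avoids A) (++-assoc s' t₁ t₂)

module Growing (next : ℕ → List Bool → List Bool)
               (next-nonempty : ∀ j p → 0 < length (next j p)) where

  chain : ℕ → List Bool
  chain zero    = []
  chain (suc j) = chain j ++ next j (chain j)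

  length-chain-increasing : Increasing (λ j → length (chain j))
  length-chain-increasing j = begin-strict
    length (chain j)                                <⟨ m<m+n _ (next-nonempty j (chain j)) ⟩
    length (chain j) + length (next j (chain j))    ≡⟨ sym (length-++ (chain j)) ⟩
    length (chain (suc j))                          ∎
    where open ≤-Reasoning

  chain-⊑ : ∀ {j j'} → j ≤′ j' → ∃ λ q → chain j' ≡ chain j ++ q
  chain-⊑ {j} ≤′-refl = [] , sym (++-identityʳ (chain j))
  chain-⊑ {j} (≤′-step {j'} j≤j') with chain-⊑ j≤j'
  ... | q , eq = q ++ next j' (chain j') , (begin
    chain j' ++ next j' (chain j')         ≡⟨ cong (_++ next j' (chain j')) eq ⟩
    (chain j ++ q) ++ next j' (chain j')   ≡⟨ ++-assoc (chain j) q _ ⟩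
    chain j ++ q ++ next j' (chain j')     ∎)
    where open ≡-Reasoning

  nth-chain : ∀ {j j' i} → j ≤ j' → i < length (chain j) → nth (chain j') i ≡ nth (chain j) i
  nth-chain {j} j≤j' i<j with chain-⊑ (≤⇒≤′ j≤j')
  ... | q , eq rewrite eq = nth-++ˡ (chain j) q i<j

  limit : Subset
  limit i = nth (chain (suc i)) i

  Extends-limit : ∀ j → Extends limit (chain j)
  Extends-limit j = nth⇒Extends limit (chain j) agree
    where
    agree : ∀ i → i < length (chain j) → limit i ≡ nth (chain j) i
    agree i i<j with ≤-total (suc i) j
    ... | inj₁ 1+i≤j = sym (nth-chain 1+i≤j
                             (increasing-inflationary length-chain-increasing (suc i)))
    ... | inj₂ j≤1+i = nth-chain j≤1+i i<j

MeetsInterval : Subset → ℕ → ℕ → Set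
MeetsInterval x l r = ∃ λ m → m < r × l ≤ m × m ∈ x

meetsInterval? : ∀ x l r → Dec (MeetsInterval x l r)
meetsInterval? x l r = anyUpTo? (λ m → l ≤? m ×-dec x m Bool.≟ true) r

UpwardClosed : Family → Set
UpwardClosed A = ∀ x y → x ⊆ y → A x → A y

module MeagerPartition (A : Family) (A-upward : UpwardClosed A)
                       (N : ℕ → Family) (N-nd : ∀ k → NowhereDense (N k))
                       (A⊆⋃N : ∀ x → A x → ∃ λ k → N k x) where

  avoider : ∀ j n → Σ (List Bool) λ t → All (λ s → Avoids (UpTo N j) (s ++ t)) (strings n)
  avoider j n = avoidAll (NowhereDense-UpTo N-nd j) (strings n)

  -- The final bit only makes blocks nonempty, so that the chain of blocks grows.
  block : ℕ → ℕ → List Bool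
  block j n = proj₁ (avoider j n) ++ false ∷ []

  block-avoids : ∀ j n {i} x → i ≤ j → N i x → ¬ Extends x (prefix x n ++ block j n)
  block-avoids j n x i≤j Nᵢx =
    All.lookup (proj₂ (avoider j n)) (prefix∈strings x n) x (_ , i≤j , Nᵢx)
    ∘′ Extends-++⁻ˡ x (prefix x n ++ proj₁ (avoider j n)) (false ∷ [])
    ∘′ subst (Extends x) (sym (++-assoc (prefix x n) (proj₁ (avoider j n)) (false ∷ [])))

  block-nonempty : ∀ j n → 0 < length (block j n)
  block-nonempty j n = subst (0 <_) (sym (length-++ (proj₁ (avoider j n)))) (m≤n+m 1 _)

  open Growing (λ j p → block j (length p)) (λ j p → block-nonempty j (length p))

  a : ℕ → ℕ
  a j = length (chain j)

  a-increasing : Increasing a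
  a-increasing = length-chain-increasing

  meets : ∀ y → A y → Eventually λ j → MeetsInterval y (a j) (a (suc j))
  meets y Ay = k , meets-from-k
    where
    y′ : Subset
    y′ m = y m ∨ limit m

    y⊆y′ : y ⊆ y′
    y⊆y′ m y∋m = cong (_∨ limit m) y∋m

    k : ℕ
    k = proj₁ (A⊆⋃N y′ (A-upward y y′ y⊆y′ Ay))

    Nₖy′ : N k y′
    Nₖy′ = proj₂ (A⊆⋃N y′ (A-upward y y′ y⊆y′ Ay))

    -- Where y misses the j-th interval, y′ agrees with limit, so it extends a block avoiding N k.
    meets-from-k : ∀ j → k ≤ j → MeetsInterval y (a j) (a (suc j))
    meets-from-k j k≤j with meetsInterval? y (a j) (a (suc j))
    ... | yes meet = meet
    ... | no  miss = ⊥-elim (block-avoids j (a j) y′ k≤j Nₖy′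
          (Extends-prefix-++ y′ (a j) (block j (a j))
            (Extends-cong (block j (a j)) agree
              (Extends-++⁻ʳ limit (chain j) (block j (a j)) (Extends-limit (suc j))))))
      where
      agree : ∀ i → i < length (block j (a j)) → limit (a j + i) ≡ y′ (a j + i)
      agree i i<b =
        sym (cong (_∨ limit (a j + i)) (¬-not λ y∋ → miss (a j + i , in-block , m≤m+n _ _ , y∋)))
        where
        in-block : a j + i < a (suc j)
        in-block = subst (a j + i <_) (sym (length-++ (chain j))) (+-monoʳ-< (a j) i<b)

meager⇒partition : (A : Family) → UpwardClosed A → Meager A →
  ∃ λ a → Increasing a × ∀ y → A y → Eventually λ j → MeetsInterval y (a j) (a (suc j))
meager⇒partition A A-upward (N , N-nd , A⊆⋃N) = a , a-increasing , meets
  where open MeagerPartition A A-upward N N-nd A⊆⋃N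

partition⇒meager : (l r : ℕ → ℕ) → (∀ k → k ≤ l k) → (A : Family) →
  (∀ x → A x → Eventually λ k → MeetsInterval x (l k) (r k)) → Meager A
partition⇒meager l r k≤l A meets = N , N-nd , meets
  where
  N : ℕ → Family
  N t x = ∀ k → t ≤ k → MeetsInterval x (l k) (r k)

  -- For k = t + |s| the k-th interval starts after s, so padding s with zeros past r k works.
  N-nd : ∀ t → NowhereDense (N t)
  N-nd t s = replicate (r k) false , λ x Nx ext → misses x (Nx k (m≤m+n t (length s))) ext
    where
    k : ℕ
    k = t + length s
    misses : ∀ x → MeetsInterval x (l k) (r k) → ¬ Extends x (s ++ replicate (r k) false)
    misses x (m , m<r , l≤m , x∋m) ext = contradiction x∋m (subst (λ n → ¬ n ∈ x) (m+[n∸m]≡n s≤m) x∌)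
      where
      s≤m : length s ≤ m
      s≤m = ≤-trans (m≤n+m (length s) t) (≤-trans (k≤l k) l≤m)
      x∌ : ¬ (length s + (m ∸ length s)) ∈ x
      x∌ = not-¬ (Extends-replicate (shift (length s) x) (r k) false (Extends-++⁻ʳ x s _ ext)
                                    (m ∸ length s) (≤-<-trans (m∸n≤m m (length s)) m<r))

does-true⇒ : ∀ {P : Set} (p? : Dec P) → does p? ≡ true → P
does-true⇒ (yes p) _ = p

choose : ∀ {A : Set} {P : A → Set} {B : A → ℕ → Set} → U.Decidable P →
  (∀ a → P a → ∃ (B a)) → ∃ λ w → ∀ a → P a → B a (w a)
choose {A} {P} {B} P? witnesses = w , w-correct
  where
  w : A → ℕ
  w a with P? a
  ... | yes pa = proj₁ (witnesses a pa)
  ... | no  _  = 0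
  w-correct : ∀ a → P a → B a (w a)
  w-correct a pa with P? a
  ... | yes pa′ = proj₂ (witnesses a pa′)
  ... | no ¬pa  = contradiction pa ¬pa

∈-inter⁺ : ∀ X Y {m} → m ∈ X → m ∈ Y → m ∈ inter X Y
∈-inter⁺ X Y {m} X∋m Y∋m with X m
∈-inter⁺ X Y refl Y∋m | true = Y∋m

∈-inter⁻ : ∀ X Y {m} → m ∈ inter X Y → m ∈ X × m ∈ Y
∈-inter⁻ X Y {m} ∋m with X m
... | true = refl , ∋m

∈-comp⁺ : ∀ X {m} → ¬ m ∈ X → m ∈ comp X
∈-comp⁺ X {m} ∌m with X m
... | true  = contradiction refl ∌m
... | false = refl

∈-comp⁻ : ∀ X {m} → m ∈ comp X → ¬ m ∈ X
∈-comp⁻ X {m} ∋m with X m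
∈-comp⁻ X () | true
... | false = λ ()

atLeast : ℕ → Subset
atLeast c m = does (c ≤? m)

∈-atLeast⁺ : ∀ {c m} → c ≤ m → m ∈ atLeast c
∈-atLeast⁺ {c} {m} = dec-true (c ≤? m)

∈-atLeast⁻ : ∀ {c m} → m ∈ atLeast c → c ≤ m
∈-atLeast⁻ {c} {m} = does-true⇒ (c ≤? m)

GenBy-upward : ∀ F X → UpwardClosed (GenBy F X)
GenBy-upward F X x y x⊆y (Y , FY , Y∩X⊆x) = Y , FY , λ m Y∋m X∋m → x⊆y m (Y∩X⊆x m Y∋m X∋m)

trim-⊆*-chain : (X : ℕ → Subset) → (∀ n → X (suc n) ⊆* X n) →
  ∃ λ c → ∀ {n i} → n ≤ i → ∀ m → c i ≤ m → m ∈ X i → m ∈ X n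
trim-⊆*-chain X X⊆*X = c , λ n≤i → trimmed (≤⇒≤′ n≤i)
  where
  c : ℕ → ℕ
  c zero    = 0
  c (suc n) = c n ⊔ proj₁ (X⊆*X n)
  trimmed : ∀ {n i} → n ≤′ i → ∀ m → c i ≤ m → m ∈ X i → m ∈ X n
  trimmed ≤′-refl           m _     X∋m = X∋m
  trimmed (≤′-step {i} n≤i) m cᵢ₊₁≤m X∋m =
    trimmed n≤i m (m⊔n≤o⇒m≤o _ _ cᵢ₊₁≤m) (proj₂ (X⊆*X i) m (m⊔n≤o⇒n≤o _ _ cᵢ₊₁≤m) X∋m)

module _ {F : Family} (isF : IsFilter F) where
  open IsFilter isF

  ⁺-mono : ∀ {X Y} → X ⊆ Y → (F ⁺) X → (F ⁺) Y
  ⁺-mono {X} {Y} X⊆Y X⁺ F∁Y =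
    X⁺ (super-closed (comp Y) (comp X) F∁Y λ m ∁Y∋m → ∈-comp⁺ X (∈-comp⁻ Y ∁Y∋m ∘′ X⊆Y m))

  ⁺-atLeast : ∀ {X} c → (F ⁺) X → (F ⁺) (inter X (atLeast c))
  ⁺-atLeast {X} c X⁺ F∁X′ =
    X⁺ (super-closed _ (comp X) (inter-closed _ _ F∁X′ F-atLeast) ∁X′∩c⊆∁X)
    where
    F-atLeast : F (atLeast c)
    F-atLeast = cofinite (atLeast c) (c , λ _ → ∈-atLeast⁺)
    ∁X′∩c⊆∁X : inter (comp (inter X (atLeast c))) (atLeast c) ⊆ comp X
    ∁X′∩c⊆∁X m ∋m with ∈-inter⁻ (comp (inter X (atLeast c))) (atLeast c) ∋m
    ... | ∁X′∋m , c≤m =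
      ∈-comp⁺ X λ X∋m → ∈-comp⁻ (inter X (atLeast c)) ∁X′∋m (∈-inter⁺ X (atLeast c) X∋m c≤m)

  Cond2⇒Cond3 : Cond2 F → Cond3 F
  Cond2⇒Cond3 cond2 X X⁺ = cond2 X λ n Z Z≈⋃ →
    ⁺-mono (λ m X∋m → Equivalence.from (Z≈⋃ m) (n , ≤-refl , X∋m)) (X⁺ n)

  Cond3⇒CompletelyMeager : Cond3 F → CompletelyMeager F
  -- Cutting X to its tails X ∩ [i, ∞) makes every caught point lie at or past its index i ≥ n k.
  Cond3⇒CompletelyMeager cond3 X X⁺ with cond3 (λ i → inter X (atLeast i)) (λ i → ⁺-atLeast i X⁺)
  ... | h , n , n-inc , catches =
    partition⇒meager n r (increasing-inflationary n-inc) (GenBy F X) meets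
    where
    r : ℕ → ℕ
    r k = maxBelow h (n (suc k))
    meets : ∀ x → GenBy F X x → Eventually λ k → MeetsInterval x (n k) (r k)
    meets x (Y , FY , Y∩X⊆x) = proj₁ (catches Y FY) , λ k K≤k → meet k (proj₂ (catches Y FY) k K≤k)
      where
      meet : ∀ k → (∃ λ i → (n k ≤ i × i < n (suc k)) ×
                     ∃ λ m → m < h i × m ∈ inter X (atLeast i) × m ∈ Y) →
             MeetsInterval x (n k) (r k)
      meet k (i , (nₖ≤i , i<nₖ₊₁) , m , m<hᵢ , X′∋m , Y∋m) with ∈-inter⁻ X (atLeast i) X′∋m
      ... | X∋m , i≤m =
        m , <-≤-trans m<hᵢ (≤-maxBelow h i<nₖ₊₁) , ≤-trans nₖ≤i (∈-atLeast⁻ i≤m) , Y∩X⊆x m Y∋m X∋m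

-- Block k of indices is [n k, n (k+1)): long enough to contain, for each m ∈ Z in the
-- interval of a used at stage k, a witness i with m ∈ X i; h i then reaches past that interval.
partition⇒Catches : (F : Family) (X : ℕ → Subset) (Z : Subset) →
  (∀ n → Eventually λ m → m ∈ Z → UnionFrom X n m) →
  (a : ℕ → ℕ) → Increasing a →
  (∀ Y → F Y → Eventually λ j → MeetsInterval (inter Y Z) (a j) (a (suc j))) →
  Catches F X
partition⇒Catches F X Z Z⊆⋃ a a-inc meets = h , n , n-inc , catches
  where
  start : ℕ → ℕ
  start n = proj₁ (Z⊆⋃ n)

  witnessed : ∀ n → ∃ λ w → ∀ m → start n ≤ m × m ∈ Z → n ≤ w m × m ∈ X (w m)
  witnessed n = choose {B = λ m i → n ≤ i × m ∈ X i} (λ m → start n ≤? m ×-dec Z m Bool.≟ true)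
                       (λ m (s≤m , Z∋m) → proj₂ (Z⊆⋃ n) m s≤m Z∋m)

  witness : ℕ → ℕ → ℕ
  witness n = proj₁ (witnessed n)

  n j : ℕ → ℕ
  n zero    = 0
  n (suc k) = suc (n k + maxBelow (witness (n k)) (a (suc (j k))))
  j zero    = start 0
  j (suc k) = suc (j k + start (n (suc k)))

  h : ℕ → ℕ
  h i = a (suc (j i))

  n-inc : Increasing n
  n-inc k = s≤s (m≤m+n (n k) _)

  j-inc : Increasing j
  j-inc k = s≤s (m≤m+n (j k) _)

  start≤j : ∀ k → start (n k) ≤ j k
  start≤j zero    = ≤-refl
  start≤j (suc k) = ≤-trans (m≤n+m _ (j k)) (n≤1+n _)

  past-start : ∀ k {m} → a (j k) ≤ m → start (n k) ≤ m
  past-start k a≤m = ≤-trans (start≤j k) (≤-trans (increasing-inflationary a-inc (j k)) a≤m)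

  catches : ∀ Y → F Y → Eventually λ k →
    ∃ λ i → (n k ≤ i × i < n (suc k)) × ∃ λ m → m < h i × m ∈ X i × m ∈ Y
  catches Y FY = K , λ k K≤k →
    catch k (proj₂ (meets Y FY) (j k) (≤-trans K≤k (increasing-inflationary j-inc k)))
    where
    K : ℕ
    K = proj₁ (meets Y FY)
    catch : ∀ k → MeetsInterval (inter Y Z) (a (j k)) (a (suc (j k))) →
      ∃ λ i → (n k ≤ i × i < n (suc k)) × ∃ λ m → m < h i × m ∈ X i × m ∈ Y
    catch k (m , m<a , a≤m , YZ∋m) with ∈-inter⁻ Y Z YZ∋m
    ... | Y∋m , Z∋m with proj₂ (witnessed (n k)) m (past-start k a≤m , Z∋m)
    ... | nₖ≤i , X∋m = i , (nₖ≤i , i<nₖ₊₁) , m , m<hᵢ , X∋m , Y∋m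
      where
      i : ℕ
      i = witness (n k) m
      i<nₖ₊₁ : i < n (suc k)
      i<nₖ₊₁ = s≤s (≤-trans (≤-maxBelow (witness (n k)) m<a) (m≤n+m _ (n k)))
      m<hᵢ : m < h i
      m<hᵢ = <-≤-trans m<a (increasing-mono a-inc (s≤s (increasing-mono j-inc
               (≤-trans (increasing-inflationary n-inc k) nₖ≤i))))

module Classical (em : ExcludedMiddle 0ℓ) where

  ⟦_⟧ : (ℕ → Set) → Subset
  ⟦ P ⟧ m = does (em {P m})

  ⟦⟧-represents : ∀ P → Represents ⟦ P ⟧ P
  ⟦⟧-represents P m = mk⇔ (does-true⇒ em) (dec-true em)

  Cond3⇒IsPPlus : ∀ {F} → IsFilter F → Cond3 F → IsPPlus F
  Cond3⇒IsPPlus {F} isF cond3 X X⁺ X⊆*X with trim-⊆*-chain X X⊆*X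
  ... | c , trimmed with cond3 (λ i → inter (X i) (atLeast (c i))) (λ i → ⁺-atLeast isF (c i) (X⁺ i))
  ... | h , _ , _ , catches = Z , Z⁺ , Z⊆*X
    where
    Caught : ℕ → Set
    Caught m = ∃ λ i → m < h i × m ∈ inter (X i) (atLeast (c i))
    Z : Subset
    Z = ⟦ Caught ⟧
    Z⁺ : (F ⁺) Z
    Z⁺ F∁Z with proj₂ (catches (comp Z) F∁Z) _ ≤-refl
    ... | i , _ , m , m<hᵢ , X′∋m , ∁Z∋m =
      ∈-comp⁻ Z ∁Z∋m (Equivalence.from (⟦⟧-represents Caught m) (i , m<hᵢ , X′∋m))
    Z⊆*X : ∀ n → Z ⊆* X n
    Z⊆*X n = maxBelow h n , λ m h≤m Z∋m →
      caught m h≤m (Equivalence.to (⟦⟧-represents Caught m) Z∋m)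
      where
      caught : ∀ m → maxBelow h n ≤ m → Caught m → m ∈ X n
      caught m h≤m (i , m<hᵢ , X′∋m) with ∈-inter⁻ (X i) (atLeast (c i)) X′∋m
      ... | X∋m , cᵢ≤m = trimmed n≤i m (∈-atLeast⁻ cᵢ≤m) X∋m
        where
        n≤i : n ≤ i
        n≤i = ≮⇒≥ λ i<n → <-irrefl refl (<-≤-trans m<hᵢ (≤-trans (≤-maxBelow h i<n) h≤m))

  UnionsFrom : (ℕ → Subset) → ℕ → Subset
  UnionsFrom X n = ⟦ UnionFrom X n ⟧

  UnionsFrom-decreasing : ∀ X n → UnionsFrom X (suc n) ⊆* UnionsFrom X n
  UnionsFrom-decreasing X n = 0 , λ m _ ∋m → Equivalence.from (⟦⟧-represents (UnionFrom X n) m)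
    (case Equivalence.to (⟦⟧-represents (UnionFrom X (suc n)) m) ∋m of
      λ (i , 1+n≤i , X∋m) → i , <⇒≤ 1+n≤i , X∋m)

  Cond1⇒Cond2 : ∀ {F} → Cond1 F → Cond2 F
  Cond1⇒Cond2 {F} (meager , pplus) X ⋃⁺
    with pplus (UnionsFrom X) (λ n → ⋃⁺ n _ (⟦⟧-represents _)) (UnionsFrom-decreasing X)
  ... | Z , Z⁺ , Z⊆*⋃ with meager⇒partition (GenBy F Z) (GenBy-upward F Z) (meager Z Z⁺)
  ... | a , a-inc , meets = partition⇒Catches F X Z Z⊆⋃ a a-inc
          (λ Y FY → meets (inter Y Z) (Y , FY , λ m → ∈-inter⁺ Y Z))
    where
    Z⊆⋃ : ∀ n → Eventually λ m → m ∈ Z → UnionFrom X n m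
    Z⊆⋃ n = proj₁ (Z⊆*⋃ n) , λ m N≤m Z∋m →
      Equivalence.to (⟦⟧-represents (UnionFrom X n) m) (proj₂ (Z⊆*⋃ n) m N≤m Z∋m)

lemma2p5 : (∀ {ℓ : Level} → ExcludedMiddle ℓ) →
    (F : Family) → IsFilter F →
    (Cond1 F ⇔ Cond2 F) × (Cond1 F ⇔ Cond3 F)
lemma2p5 lem F isF =
  mk⇔ Cond1⇒Cond2 (Cond3⇒Cond1 ∘′ Cond2⇒Cond3 isF) ,
  mk⇔ (Cond2⇒Cond3 isF ∘′ Cond1⇒Cond2) Cond3⇒Cond1
  where
  open Classical lem
  Cond3⇒Cond1 : Cond3 F → Cond1 F
  Cond3⇒Cond1 cond3 = Cond3⇒CompletelyMeager isF cond3 , Cond3⇒IsPPlus isF cond3
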